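{- Assume the law of excluded middle. Then a complete lattice is an overlap algebra if and only if it is a complete Boolean algebra.
   Context: A positivity predicate on a complete lattice $L$ is a unary predicate $\mathrm{Pos}$ such that for all $x,y\in L$ and $X\subseteq L$: (i) $\mathrm{Pos}(x)$ and $x\leq y$ imply $\mathrm{Pos}(y)$; (ii) $\mathrm{Pos}(\bigvee X)$ implies $\mathrm{Pos}(x)$ for some $x\in X$; (iii) if $\mathrm{Pos}(x)\Rightarrow x\leq y$, then $x\leq y$. $L$ is overt if it has a positivity predicate. An overlap algebra (o-algebra) is an overt frame $L$ such that for all $x,y\in L$: if for all $z\in L$, $\mathrm{Pos}(z\wedge x)\Rightarrow\mathrm{Pos}(z\wedge y)$, then $x\leq y$. -}

module Defs where

open import Level using (Level; suc; Lift)
open import Data.Empty using (⊥)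
open import Data.Unit using (⊤)
open import Data.Sum using (_⊎_)
open import Data.Product using (Σ; ∃; _×_)
open import Relation.Nullary using (¬_)
open import Relation.Unary using (Pred)
open import Relation.Binary.Bundles using (Poset)
open import Algebra.Lattice.Structures using (IsBooleanAlgebra)

LEM : (ℓ : Level) → Set (suc ℓ)
LEM ℓ = (P : Set ℓ) → P ⊎ ¬ P

record CompleteLattice (ℓ : Level) : Set (suc ℓ) where
  field
    poset    : Poset ℓ ℓ ℓ
  open Poset poset public
  field
    ⋁        : Pred Carrier ℓ → Carrier
    ⋁-upper  : ∀ (X : Pred Carrier ℓ) x → X x → x ≤ ⋁ X
    ⋁-least  : ∀ (X : Pred Carrier ℓ) y → (∀ x → X x → x ≤ y) → ⋁ X ≤ y

  ⊥ₗ : Carrier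
  ⊥ₗ = ⋁ (λ _ → Lift ℓ ⊥)

  ⊤ₗ : Carrier
  ⊤ₗ = ⋁ (λ _ → Lift ℓ ⊤)

  _∨_ : Carrier → Carrier → Carrier
  x ∨ y = ⋁ (λ z → z ≈ x ⊎ z ≈ y)

  _∧_ : Carrier → Carrier → Carrier
  x ∧ y = ⋁ (λ z → z ≤ x × z ≤ y)

module _ {ℓ : Level} (L : CompleteLattice ℓ) where
  open CompleteLattice L

  IsFrame : Set (suc ℓ)
  IsFrame = ∀ (x : Carrier) (X : Pred Carrier ℓ) →
    (x ∧ ⋁ X) ≈ ⋁ (λ z → ∃ λ y → X y × (z ≈ (x ∧ y)))

  record IsPositivity (Pos : Pred Carrier ℓ) : Set (suc ℓ) where
    field
      pos-mono  : ∀ x y → Pos x → x ≤ y → Pos y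
      pos-split : ∀ (X : Pred Carrier ℓ) → Pos (⋁ X) → ∃ λ x → X x × Pos x
      pos-le    : ∀ x y → (Pos x → x ≤ y) → x ≤ y

  IsOvert : Set (suc ℓ)
  IsOvert = Σ (Pred Carrier ℓ) IsPositivity

  IsOAlgebra : Set (suc ℓ)
  IsOAlgebra = IsFrame × Σ (Pred Carrier ℓ) λ Pos → IsPositivity Pos ×
    (∀ x y → (∀ z → Pos (z ∧ x) → Pos (z ∧ y)) → x ≤ y)

  IsCompleteBooleanAlgebra : Set ℓ
  IsCompleteBooleanAlgebra =
    Σ (Carrier → Carrier) λ ¬ₗ → IsBooleanAlgebra _≈_ _∨_ _∧_ ¬ₗ ⊤ₗ ⊥ₗ

module Submission where

-- In a Boolean algebra meeting with a is left adjoint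
-- to joining with ¬a (shunting), so a ∧ - preserves all joins: the lattice is
-- a frame.  Under LEM, "x ≰ ⊥" is a positivity predicate on every complete
-- lattice, and it separates: if x ≰ y then ¬y ∧ x is positive while
-- ¬y ∧ y is not.
--
-- A frame is distributive and has the pseudocomplement
-- ¬x = ⋁ {z | z ∧ x ≤ ⊥}.  Separation, together with LEM applied to
-- Pos (z ∧ x), shows that ⊤ ≤ x ∨ ¬x, so ¬x is a Boolean complement.

open import Defs
open import Level using (Level; lift)
open import Data.Product using (_×_; _,_; proj₁; proj₂; ∃)
open import Data.Sum using (_⊎_; inj₁; inj₂)
open import Data.Empty using (⊥-elim)
open import Data.Unit using (tt)
open import Relation.Nullary using (¬_)
open import Relation.Unary using (Pred)
import Relation.Binary.Lattice as RL
import Relation.Binary.Lattice.Properties.Lattice as LatticeProperties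
import Relation.Binary.Lattice.Properties.DistributiveLattice as DistributiveProperties
import Algebra.Lattice.Structures as AlgebraStructures
import Relation.Binary.Reasoning.PartialOrder as PartialOrderReasoning

stable : {ℓ : Level} → LEM ℓ → (P : Set ℓ) → ¬ ¬ P → P
stable lem P ¬¬p with lem P
... | inj₁ p  = p
... | inj₂ ¬p = ⊥-elim (¬¬p ¬p)

module LatticeFacts {ℓ : Level} (L : CompleteLattice ℓ) where
  open CompleteLattice L

  ⊥-least : ∀ x → ⊥ₗ ≤ x
  ⊥-least x = ⋁-least _ x (λ _ ())

  ⊤-greatest : ∀ x → x ≤ ⊤ₗ
  ⊤-greatest x = ⋁-upper _ x (lift tt)

  ∨-upperˡ : ∀ x y → x ≤ x ∨ y
  ∨-upperˡ x y = ⋁-upper _ x (inj₁ Eq.refl)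

  ∨-upperʳ : ∀ x y → y ≤ x ∨ y
  ∨-upperʳ x y = ⋁-upper _ y (inj₂ Eq.refl)

  ∨-least : ∀ {x y z} → x ≤ z → y ≤ z → x ∨ y ≤ z
  ∨-least {x} {y} {z} x≤z y≤z = ⋁-least _ z below
    where
    below : ∀ w → w ≈ x ⊎ w ≈ y → w ≤ z
    below w (inj₁ w≈x) = trans (reflexive w≈x) x≤z
    below w (inj₂ w≈y) = trans (reflexive w≈y) y≤z

  ∧-lowerˡ : ∀ x y → x ∧ y ≤ x
  ∧-lowerˡ x y = ⋁-least _ x (λ _ → proj₁)

  ∧-lowerʳ : ∀ x y → x ∧ y ≤ y
  ∧-lowerʳ x y = ⋁-least _ y (λ _ → proj₂)

  ∧-greatest : ∀ {z x y} → z ≤ x → z ≤ y → z ≤ x ∧ y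
  ∧-greatest {z} z≤x z≤y = ⋁-upper _ z (z≤x , z≤y)

  ∧-mono : ∀ {a a′ b b′} → a ≤ a′ → b ≤ b′ → a ∧ b ≤ a′ ∧ b′
  ∧-mono {a} {a′} {b} {b′} a≤a′ b≤b′ =
    ∧-greatest (trans (∧-lowerˡ a b) a≤a′) (trans (∧-lowerʳ a b) b≤b′)

  ∨-mono : ∀ {a a′ b b′} → a ≤ a′ → b ≤ b′ → a ∨ b ≤ a′ ∨ b′
  ∨-mono {a} {a′} {b} {b′} a≤a′ b≤b′ =
    ∨-least (trans a≤a′ (∨-upperˡ a′ b′)) (trans b≤b′ (∨-upperʳ a′ b′))

  ∧-swap : ∀ a b → a ∧ b ≤ b ∧ a
  ∧-swap a b = ∧-greatest (∧-lowerʳ a b) (∧-lowerˡ a b)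

  ∨-swap : ∀ a b → a ∨ b ≤ b ∨ a
  ∨-swap a b = ∨-least (∨-upperʳ b a) (∨-upperˡ b a)

  -- L as an order-theoretic lattice, to reuse the library's algebraic laws.
  lattice : RL.Lattice ℓ ℓ ℓ
  lattice = record
    { isLattice = record
      { isPartialOrder = isPartialOrder
      ; supremum       = λ x y → ∨-upperˡ x y , ∨-upperʳ x y , λ _ → ∨-least
      ; infimum        = λ x y → ∧-lowerˡ x y , ∧-lowerʳ x y , λ _ → ∧-greatest } }

  open AlgebraStructures _≈_ using (IsDistributiveLattice)

  distributive : (∀ x y z → x ∧ (y ∨ z) ≤ (x ∧ y) ∨ (x ∧ z)) →
                 IsDistributiveLattice _∨_ _∧_
  distributive distrib≤ = record
    { isLattice   = LatticeProperties.isAlgLattice lattice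
    ; ∨-distrib-∧ = DistributiveProperties.∨-distrib-∧ distributiveLattice
    ; ∧-distrib-∨ = DistributiveProperties.∧-distrib-∨ distributiveLattice }
    where
    distributiveLattice : RL.DistributiveLattice ℓ ℓ ℓ
    distributiveLattice = record { isDistributiveLattice = record
      { isLattice    = RL.Lattice.isLattice lattice
      ; ∧-distribˡ-∨ = λ x y z → antisym (distrib≤ x y z)
          (∨-least (∧-mono refl (∨-upperˡ y z)) (∧-mono refl (∨-upperʳ y z))) } }

module FrameFacts {ℓ : Level} (L : CompleteLattice ℓ) (frame : IsFrame L) where
  open CompleteLattice L
  open LatticeFacts L

  ∧-⋁-least : ∀ x (X : Pred Carrier ℓ) c → (∀ y → X y → x ∧ y ≤ c) → x ∧ ⋁ X ≤ c
  ∧-⋁-least x X c bound = trans (reflexive (frame x X)) (⋁-least _ c below)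
    where
    below : ∀ w → (∃ λ y → X y × (w ≈ (x ∧ y))) → w ≤ c
    below w (y , y∈X , w≈x∧y) = trans (reflexive w≈x∧y) (bound y y∈X)

  ∧-distribˡ-∨-≤ : ∀ x y z → x ∧ (y ∨ z) ≤ (x ∧ y) ∨ (x ∧ z)
  ∧-distribˡ-∨-≤ x y z = ∧-⋁-least x _ _ bound
    where
    bound : ∀ v → v ≈ y ⊎ v ≈ z → x ∧ v ≤ (x ∧ y) ∨ (x ∧ z)
    bound v (inj₁ v≈y) = trans (∧-mono refl (reflexive v≈y)) (∨-upperˡ _ _)
    bound v (inj₂ v≈z) = trans (∧-mono refl (reflexive v≈z)) (∨-upperʳ _ _)

nonpositive⇒⊥ : {ℓ : Level} (L : CompleteLattice ℓ) {Pos : Pred (CompleteLattice.Carrier L) ℓ} →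
                IsPositivity L Pos → ∀ x → ¬ Pos x → CompleteLattice._≤_ L x (CompleteLattice.⊥ₗ L)
nonpositive⇒⊥ L P x ¬pos = IsPositivity.pos-le P x _ (λ pos → ⊥-elim (¬pos pos))

module NonBottom {ℓ : Level} (lem : LEM ℓ) (L : CompleteLattice ℓ) where
  open CompleteLattice L
  open LatticeFacts L

  NonBottom : Pred Carrier ℓ
  NonBottom x = ¬ (x ≤ ⊥ₗ)

  nonBottom-positivity : IsPositivity L NonBottom
  nonBottom-positivity = record
    { pos-mono  = λ x y x≰⊥ x≤y y≤⊥ → x≰⊥ (trans x≤y y≤⊥)
    ; pos-split = split
    ; pos-le    = below }
    where
    -- If every element of X were ≤ ⊥, then so would be ⋁ X.
    split : ∀ (X : Pred Carrier ℓ) → NonBottom (⋁ X) → ∃ λ x → X x × NonBottom x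
    split X ⋁X≰⊥ = stable lem _ λ none →
      ⋁X≰⊥ (⋁-least X ⊥ₗ (λ x x∈X → stable lem _ (λ x≰⊥ → none (x , x∈X , x≰⊥))))

    below : ∀ x y → (NonBottom x → x ≤ y) → x ≤ y
    below x y f with lem (x ≤ ⊥ₗ)
    ... | inj₁ x≤⊥ = trans x≤⊥ (⊥-least y)
    ... | inj₂ x≰⊥ = f x≰⊥

module BooleanFacts {ℓ : Level} (L : CompleteLattice ℓ) (¬ₗ : CompleteLattice.Carrier L → CompleteLattice.Carrier L)
       (boolean : AlgebraStructures.IsBooleanAlgebra (CompleteLattice._≈_ L) (CompleteLattice._∨_ L)
                    (CompleteLattice._∧_ L) ¬ₗ (CompleteLattice.⊤ₗ L) (CompleteLattice.⊥ₗ L)) where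
  open CompleteLattice L
  open LatticeFacts L
  open PartialOrderReasoning poset
  open AlgebraStructures.IsBooleanAlgebra boolean using (∧-congˡ; ∧-distribˡ-∨; ∧-complementˡ; ∧-complementʳ; ∨-complementʳ)

  split : ∀ a b → b ≤ (b ∧ a) ∨ (b ∧ ¬ₗ a)
  split a b = begin
    b                     ≤⟨ ∧-greatest refl (⊤-greatest b) ⟩
    b ∧ ⊤ₗ                ≈⟨ ∧-congˡ (Eq.sym (∨-complementʳ a)) ⟩
    b ∧ (a ∨ ¬ₗ a)        ≈⟨ ∧-distribˡ-∨ b a (¬ₗ a) ⟩
    (b ∧ a) ∨ (b ∧ ¬ₗ a)  ∎

  shunt : ∀ a b c → a ∧ b ≤ c → b ≤ c ∨ ¬ₗ a
  shunt a b c a∧b≤c = trans (split a b)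
    (∨-mono (trans (∧-swap b a) a∧b≤c) (∧-lowerʳ b (¬ₗ a)))

  unshunt : ∀ a b c → b ≤ c ∨ ¬ₗ a → a ∧ b ≤ c
  unshunt a b c b≤c∨¬a = begin
    a ∧ b                  ≤⟨ ∧-mono refl b≤c∨¬a ⟩
    a ∧ (c ∨ ¬ₗ a)         ≈⟨ ∧-distribˡ-∨ a c (¬ₗ a) ⟩
    (a ∧ c) ∨ (a ∧ ¬ₗ a)   ≤⟨ ∨-least (∧-lowerʳ a c) (trans (reflexive (∧-complementʳ a)) (⊥-least c)) ⟩
    c                      ∎

  disjoint⇒≤ : ∀ a b → b ∧ ¬ₗ a ≤ ⊥ₗ → b ≤ a
  disjoint⇒≤ a b b∧¬a≤⊥ =
    trans (split a b) (∨-least (∧-lowerʳ b a) (trans b∧¬a≤⊥ (⊥-least a)))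

  ¬a∧a≤⊥ : ∀ a → ¬ₗ a ∧ a ≤ ⊥ₗ
  ¬a∧a≤⊥ a = reflexive (∧-complementˡ a)

  -- Every complete Boolean algebra is a frame: x ∧ - is a left adjoint.
  frame : IsFrame L
  frame x X = antisym meet≤join join≤meet
    where
    S : Pred Carrier ℓ
    S z = ∃ λ y → X y × (z ≈ (x ∧ y))

    meet≤join : x ∧ ⋁ X ≤ ⋁ S
    meet≤join = unshunt x (⋁ X) (⋁ S) (⋁-least X _ λ y y∈X →
      shunt x y (⋁ S) (⋁-upper S (x ∧ y) (y , y∈X , Eq.refl)))

    join≤meet : ⋁ S ≤ x ∧ ⋁ X
    join≤meet = ⋁-least S _ λ { w (y , y∈X , w≈x∧y) →
      trans (reflexive w≈x∧y) (∧-mono refl (⋁-upper X y y∈X)) }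

cba⇒oalgebra : {ℓ : Level} → LEM ℓ → (L : CompleteLattice ℓ) →
               IsCompleteBooleanAlgebra L → IsOAlgebra L
cba⇒oalgebra lem L (¬ₗ , boolean) = frame , NonBottom , nonBottom-positivity , separates
  where
  open CompleteLattice L
  open LatticeFacts L
  open NonBottom lem L
  open BooleanFacts L ¬ₗ boolean

  -- If x ≰ y then z = ¬y witnesses the failure of the hypothesis.
  separates : ∀ x y → (∀ z → NonBottom (z ∧ x) → NonBottom (z ∧ y)) → x ≤ y
  separates x y h = disjoint⇒≤ y x (trans (∧-swap x (¬ₗ y)) ¬y∧x≤⊥)
    where
    ¬y∧x≤⊥ : ¬ₗ y ∧ x ≤ ⊥ₗ
    ¬y∧x≤⊥ = nonpositive⇒⊥ L nonBottom-positivity _ (λ pos → h (¬ₗ y) pos (¬a∧a≤⊥ y))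

module OAlgebraFacts {ℓ : Level} (lem : LEM ℓ) (L : CompleteLattice ℓ) (frame : IsFrame L)
       (Pos : Pred (CompleteLattice.Carrier L) ℓ) (positivity : IsPositivity L Pos)
       (separates : ∀ x y → (∀ z → Pos (CompleteLattice._∧_ L z x) → Pos (CompleteLattice._∧_ L z y)) →
                    CompleteLattice._≤_ L x y) where
  open CompleteLattice L
  open LatticeFacts L
  open FrameFacts L frame
  open IsPositivity positivity using (pos-mono)

  pseudocomplement : Carrier → Carrier
  pseudocomplement x = ⋁ (λ z → z ∧ x ≤ ⊥ₗ)

  disjoint⇒≤¬ : ∀ x z → z ∧ x ≤ ⊥ₗ → z ≤ pseudocomplement x
  disjoint⇒≤¬ x z = ⋁-upper _ z

  x∧¬x≤⊥ : ∀ x → x ∧ pseudocomplement x ≤ ⊥ₗ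
  x∧¬x≤⊥ x = ∧-⋁-least x _ ⊥ₗ (λ v v∧x≤⊥ → trans (∧-swap x v) v∧x≤⊥)

  ¬-antitone : ∀ {x y} → x ≤ y → pseudocomplement y ≤ pseudocomplement x
  ¬-antitone x≤y = ⋁-least _ _ λ z z∧y≤⊥ → disjoint⇒≤¬ _ z (trans (∧-mono refl x≤y) z∧y≤⊥)

  -- Each z meets x positively or lies below ¬x; separation then gives ⊤ ≤ x ∨ ¬x.
  ⊤≤x∨¬x : ∀ x → ⊤ₗ ≤ x ∨ pseudocomplement x
  ⊤≤x∨¬x x = separates ⊤ₗ (x ∨ pseudocomplement x) covers
    where
    covers : ∀ z → Pos (z ∧ ⊤ₗ) → Pos (z ∧ (x ∨ pseudocomplement x))
    covers z z∧⊤-pos with lem (Pos (z ∧ x))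
    ... | inj₁ z∧x-pos = pos-mono _ _ z∧x-pos (∧-mono refl (∨-upperˡ _ _))
    ... | inj₂ z∧x-nonpos = pos-mono _ _ z∧⊤-pos (∧-greatest (∧-lowerˡ z ⊤ₗ)
            (trans (∧-lowerˡ z ⊤ₗ) (trans z≤¬x (∨-upperʳ _ _))))
      where
      z≤¬x : z ≤ pseudocomplement x
      z≤¬x = disjoint⇒≤¬ x z (nonpositive⇒⊥ L positivity _ z∧x-nonpos)

  isBooleanAlgebra : IsCompleteBooleanAlgebra L
  isBooleanAlgebra = pseudocomplement , record
    { isDistributiveLattice = distributive ∧-distribˡ-∨-≤
    ; ∨-complement = (λ x → antisym (⊤-greatest _) (trans (⊤≤x∨¬x x) (∨-swap _ _)))
                   , (λ x → antisym (⊤-greatest _) (⊤≤x∨¬x x))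
    ; ∧-complement = (λ x → antisym (trans (∧-swap _ _) (x∧¬x≤⊥ x)) (⊥-least _))
                   , (λ x → antisym (x∧¬x≤⊥ x) (⊥-least _))
    ; ¬-cong       = λ x≈y → antisym (¬-antitone (reflexive (Eq.sym x≈y))) (¬-antitone (reflexive x≈y)) }

oalgebra⇒cba : {ℓ : Level} → LEM ℓ → (L : CompleteLattice ℓ) →
               IsOAlgebra L → IsCompleteBooleanAlgebra L
oalgebra⇒cba lem L (frame , Pos , positivity , separates) =
  OAlgebraFacts.isBooleanAlgebra lem L frame Pos positivity separates

proposition2p2 : {ℓ : Level} → LEM ℓ → (L : CompleteLattice ℓ) →
    (IsOAlgebra L → IsCompleteBooleanAlgebra L) × (IsCompleteBooleanAlgebra L → IsOAlgebra L)
proposition2p2 lem L = oalgebra⇒cba lem L , cba⇒oalgebra lem L
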